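{- For every integer $k \geq 1$, let $H_k$ be the graph with vertex set $\{a_1,\dots,a_k\}\cup\{b_1,\dots,b_k\}\cup\{c_1,\dots,c_k\}$ and edge set \[ \{a_ib_i,\ b_ic_i,\ c_ia_i : 1\le i\le k\} \cup \{c_ia_{i+1} : 1 \le i \le k-1\} \cup \{a_1a_i,\ a_1c_i : 2 \le i \le k\}. \] Then $H_k$ is a maximal outerplanar graph of order $n = 3k$ and $\gamma_{st}(H_k) = 2k = \lfloor 2n/3 \rfloor$; in particular the set $\{a_1,c_1,a_2,c_2,\dots,a_k,c_k\}$ is a minimum secure total dominating set of $H_k$.
   Context: All graphs are finite, simple and undirected. A graph is outerplanar if it has a crossing-free embedding in the plane such that all vertices lie on the boundary of the outer face; it is maximal outerplanar if it is outerplanar and adding any single new edge yields a graph that is not outerplanar. A set $S \subseteq V(G)$ is a total dominating set if every vertex of $G$ is adjacent to some vertex of $S$. A total dominating set $S$ is a secure total dominating set if for every $u \in V(G)\setminus S$ there exists $v \in S$ with $uv \in E(G)$ such that $(S\setminus\{v\})\cup\{u\}$ is also a total dominating set. $\gamma_{st}(G)$ is the minimum cardinality of a secure total dominating set of $G$. -}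

module Defs where

open import Data.Nat using (ℕ; zero; suc; _*_)
open import Data.Fin using (Fin; zero; suc; toℕ; quotRem; _<_)
open import Data.Fin.Subset using (Subset; _∈_; _∉_; _-_; _∪_; ⁅_⁆; inside; outside; ∣_∣)
open import Data.Fin.Permutation using (Permutation′; _⟨$⟩ʳ_)
open import Data.Product using (Σ; ∃; _×_; _,_; proj₁; proj₂)
open import Data.Sum using (_⊎_; inj₁; inj₂)
open import Data.Empty using (⊥)
open import Data.Bool using (Bool; true; false)
open import Data.Vec using (tabulate)
open import Relation.Nullary using (¬_)
open import Relation.Binary.PropositionalEquality using (_≡_; _≢_; refl)

record Graph (n : ℕ) : Set₁ where
  field
    Adj    : Fin n → Fin n → Set
    sym    : ∀ {u v} → Adj u v → Adj v u
    irrefl : ∀ {v} → ¬ Adj v v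
open Graph public

addEdge : ∀ {n} (G : Graph n) (u v : Fin n) → u ≢ v → Graph n
addEdge G u v u≢v = record
  { Adj    = λ x y → Adj G x y ⊎ ((x ≡ u × y ≡ v) ⊎ (x ≡ v × y ≡ u))
  ; sym    = sy
  ; irrefl = ir
  }
  where
  sy : ∀ {x y} → Adj G x y ⊎ ((x ≡ u × y ≡ v) ⊎ (x ≡ v × y ≡ u))
              → Adj G y x ⊎ ((y ≡ u × x ≡ v) ⊎ (y ≡ v × x ≡ u))
  sy (inj₁ a) = inj₁ (sym G a)
  sy (inj₂ (inj₁ (p , q))) = inj₂ (inj₂ (q , p))
  sy (inj₂ (inj₂ (p , q))) = inj₂ (inj₁ (q , p))
  ir : ∀ {x} → ¬ (Adj G x x ⊎ ((x ≡ u × x ≡ v) ⊎ (x ≡ v × x ≡ u)))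
  ir (inj₁ a) = irrefl G a
  ir (inj₂ (inj₁ (refl , refl))) = u≢v refl
  ir (inj₂ (inj₂ (refl , refl))) = u≢v refl

-- A graph is outerplanar iff its vertices can be placed
-- on a circle (in some cyclic order σ) so that the edges, drawn as
-- chords, do not cross.  Two chords uv and xy cross iff their endpoints
-- interleave along the circle: σ u < σ x < σ v < σ y.

NonCrossing : ∀ {n} → Graph n → Permutation′ n → Set
NonCrossing G σ = ∀ u v x y → Adj G u v → Adj G x y →
  ¬ ((σ ⟨$⟩ʳ u) < (σ ⟨$⟩ʳ x) × (σ ⟨$⟩ʳ x) < (σ ⟨$⟩ʳ v) × (σ ⟨$⟩ʳ v) < (σ ⟨$⟩ʳ y))

Outerplanar : ∀ {n} → Graph n → Set
Outerplanar {n} G = Σ (Permutation′ n) (NonCrossing G)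

MaximalOuterplanar : ∀ {n} → Graph n → Set
MaximalOuterplanar {n} G =
  Outerplanar G ×
  (∀ (u v : Fin n) (u≢v : u ≢ v) → ¬ Adj G u v → ¬ Outerplanar (addEdge G u v u≢v))

TotalDominating : ∀ {n} → Graph n → Subset n → Set
TotalDominating G S = ∀ v → ∃ λ u → u ∈ S × Adj G v u

swapIn : ∀ {n} → Subset n → Fin n → Fin n → Subset n
swapIn S v u = (S - v) ∪ ⁅ u ⁆

SecureTotalDominating : ∀ {n} → Graph n → Subset n → Set
SecureTotalDominating G S =
  TotalDominating G S ×
  (∀ u → u ∉ S → ∃ λ v → v ∈ S × Adj G u v × TotalDominating G (swapIn S v u))

MinimumSTDS : ∀ {n} → Graph n → Subset n → Set
MinimumSTDS {n} G S =
  SecureTotalDominating G S × (∀ (T : Subset n) → SecureTotalDominating G T → ∣ S ∣ Data.Nat.≤ ∣ T ∣)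

γst≡ : ∀ {n} → Graph n → ℕ → Set
γst≡ {n} G m =
  (∃ λ (S : Subset n) → SecureTotalDominating G S × ∣ S ∣ ≡ m) ×
  (∀ (T : Subset n) → SecureTotalDominating G T → m Data.Nat.≤ ∣ T ∣)

-- The graph H_k.  Vertices are encoded as (i , t) with i : Fin k (index,
-- 0-based) and t : Fin 3 (0 = a, 1 = b, 2 = c); vertex (i , t) is the
-- element 3·i + t of Fin (k * 3).

aT bT cT : Fin 3
aT = zero
bT = suc zero
cT = suc (suc zero)

data HE (k : ℕ) : Fin k × Fin 3 → Fin k × Fin 3 → Set where
  ab    : ∀ i → HE k (i , aT) (i , bT)
  bc    : ∀ i → HE k (i , bT) (i , cT)
  ca    : ∀ i → HE k (i , cT) (i , aT)
  cnext : ∀ i j → toℕ j ≡ suc (toℕ i) → HE k (i , cT) (j , aT)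
  a₁a   : ∀ i j → toℕ i ≡ 0 → toℕ j ≢ 0 → HE k (i , aT) (j , aT)
  a₁c   : ∀ i j → toℕ i ≡ 0 → toℕ j ≢ 0 → HE k (i , aT) (j , cT)

HE-irrefl : ∀ {k x} → ¬ HE k x x
HE-irrefl (a₁a i .i p q) = q p

decode : ∀ {k} → Fin (k * 3) → Fin k × Fin 3
decode {k} v = proj₂ (quotRem {k} 3 v) , proj₁ (quotRem {k} 3 v)

H : (k : ℕ) → Graph (k * 3)
H k = record
  { Adj    = λ u v → HE k (decode u) (decode v) ⊎ HE k (decode v) (decode u)
  ; sym    = λ { (inj₁ e) → inj₂ e ; (inj₂ e) → inj₁ e }
  ; irrefl = λ { (inj₁ e) → HE-irrefl e ; (inj₂ e) → HE-irrefl e }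
  }

isAC : Fin 3 → Bool
isAC zero = true
isAC (suc zero) = false
isAC (suc (suc zero)) = true

S₀ : (k : ℕ) → Subset (k * 3)
S₀ k = tabulate (λ v → isAC (proj₂ (decode {k} v)))

{-# OPTIONS --safe #-}
module Submission where

-- Vertex (i , t) sits at position 3i + t, and in this order a₁ b₁ c₁ a₂ … c_k a₁ is a Hamiltonian
-- cycle of H_k.  The remaining edges a_i c_i and the fan at a₁ do not cross, so the identity
-- permutation witnesses outerplanarity.  Every non-edge uv of H_k is crossed, in this cyclic
-- order, by an edge of H_k: by a_i c_i if an end is b_i, and otherwise by the fan edge from a₁ to
-- the successor of the smaller end in the sequence a₁ c₁ a₂ c₂ … a_k c_k.
-- Two crossing chords u < x < v < y of a Hamiltonian cycle rule out an outerplanar embedding: the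
-- arcs and the two chords pair {u, x, v, y} in all three ways by vertex-disjoint paths, disjoint
-- paths never separate each other's ends, and yet of the three pairings of four points on a circle
-- exactly one crosses.  Separation is detected by the parity Between a b c = [a < c] xor [b < c].
--
-- If b ∉ T for a secure total dominating set T, then the defender of b and the vertex that
-- dominates b after the swap are two distinct neighbours of b in T.  Since N(b_i) = {a_i, c_i},
-- every triangle a_i b_i c_i meets T at least twice, so γ_st(H_k) ≥ 2k; the set {a_i, c_i}
-- attains this, b_i being defended by a_i, after which c_i is dominated by b_i.

open import Data.Bool using (Bool; true; false; _xor_)
open import Data.Bool.Properties using (xor-comm; xor-same; xor-∧-commutativeRing)
open import Data.Empty using (⊥; ⊥-elim)
open import Data.Fin using (Fin; zero; suc; toℕ; fromℕ; fromℕ<; combine; _≟_)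
open import Data.Fin.Permutation using (Permutation′; _⟨$⟩ʳ_; _⟨$⟩ˡ_; inverseˡ; id)
open import Data.Fin.Properties
  using (toℕ-injective; toℕ<n; toℕ-fromℕ; toℕ-fromℕ<; toℕ-combine; remQuot-combine; combine-remQuot)
  renaming (<⇒≢ to <⇒≢ᶠ)
open import Data.Fin.Subset using (Subset; inside; outside; _∈_; _∉_; _-_; ⁅_⁆; ∣_∣)
open import Data.Fin.Subset.Properties
  using (_∈?_; x∈p∪q⁻; x∈p∪q⁺; x∈⁅x⁆; x∈⁅y⁆⇒x≡y; x∈p∧x≢y⇒x∈p-y; p─q⊆p; ∣p∣≤∣x∷p∣)
open import Data.Maybe using (just; nothing)
import Data.Nat as ℕ
open import Data.Nat using (ℕ; zero; suc; _+_; _*_; _∸_; _/_; _<_; _≤_; z≤n; s≤s; s≤s⁻¹; z<s)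
open import Data.Nat.DivMod using (m*n/n≡m)
open import Data.Nat.Properties
  using (_<?_; <-cmp; <-trans; <-irrefl; <-asym; <⇒≤; <⇒≱; ≤⇒≯; ≤-refl; ≤-trans; ≤-reflexive;
         ≤-<-trans; ≤-antisym; n<1+n; m<m+n; m<n+m; m≤n+m; m≤n⇒m≤1+n; m≤n⇒m<n∨m≡n; m+[n∸m]≡n;
         n>0⇒n≢0; 1+n≢0; suc-injective; +-suc; +-identityʳ; +-comm; *-comm; *-assoc;
         +-monoˡ-<; +-mono-≤; *-monoˡ-≤; *-cancelʳ-<; module ≤-Reasoning)
open import Data.Product using (∃; ∃₂; _×_; _,_; proj₁; proj₂)
open import Data.Sum using (_⊎_; inj₁; inj₂; swap) renaming (map to ⊎-map)
open import Data.Vec using ([]; _∷_; _++_; lookup; there)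
open import Data.Vec.Properties using ([]=⇒lookup; lookup⇒[]=; lookup∘tabulate)
open import Function using (_∘_)
open import Level using (0ℓ)
open import Relation.Binary using (Rel; tri<; tri≈; tri>)
open import Relation.Binary.Construct.Closure.ReflexiveTransitive using (Star; ε; _◅_; _◅◅_)
import Relation.Binary.Construct.Closure.ReflexiveTransitive as Star
open import Relation.Binary.PropositionalEquality
open import Relation.Nullary using (¬_; does; yes; no)
open import Relation.Nullary.Decidable using (dec-true; dec-false)
open import Relation.Unary using (Pred; _⊆_) renaming (_⊥_ to Disjoint)
open import Tactic.RingSolver using (solve-∀)
open import Tactic.RingSolver.Core.AlmostCommutativeRing using (AlmostCommutativeRing; fromCommutativeRing)

open import Defs renaming (sym to adj-sym)

-- Chords of a circle

-- The solver computes coefficients in Bool itself, so it also cancels x xor x.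
xor-ring : AlmostCommutativeRing 0ℓ 0ℓ
xor-ring = fromCommutativeRing xor-∧-commutativeRing λ { false → just refl ; true → nothing }

xor-telescope : ∀ x y z → x xor z ≡ (x xor y) xor (y xor z)
xor-telescope = solve-∀ xor-ring

xor-pairings : ∀ lac lbc lad lbd lab lcb lcd ldb ldc →
  ((lac xor lbc) xor (lad xor lbd)) xor (((lab xor lcb) xor (lad xor lcd)) xor ((lab xor ldb) xor (lac xor ldc)))
  ≡ (lbc xor lcb) xor ((lbd xor ldb) xor (lcd xor ldc))
xor-pairings = solve-∀ xor-ring

-- For c ∉ {a, b}: whether c lies strictly between a and b.
Between : ℕ → ℕ → ℕ → Bool
Between a b c = does (a <? c) xor does (b <? c)

SameSide : ℕ → ℕ → ℕ → ℕ → Set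
SameSide a b c d = Between a b c ≡ Between a b d

Crossing : ℕ → ℕ → ℕ → ℕ → Set
Crossing u v x y = u < x × x < v × v < y

Between-self : ∀ a c → Between a a c ≡ false
Between-self a c = xor-same (does (a <? c))

Between-split : ∀ a b c x → Between a c x ≡ Between a b x xor Between b c x
Between-split a b c x = xor-telescope (does (a <? x)) (does (b <? x)) (does (c <? x))

SameSide-comm : ∀ a b c d → SameSide b a c d → SameSide a b c d
SameSide-comm a b c d e =
  trans (xor-comm (does (a <? c)) (does (b <? c))) (trans e (xor-comm (does (b <? d)) (does (a <? d))))

module _ {a b c : ℕ} where

  Between-inside : a < c → c ≤ b → Between a b c ≡ true
  Between-inside a<c c≤b rewrite dec-true (a <? c) a<c | dec-false (b <? c) (≤⇒≯ c≤b) = refl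

  Between-below : c ≤ a → c ≤ b → Between a b c ≡ false
  Between-below c≤a c≤b rewrite dec-false (a <? c) (≤⇒≯ c≤a) | dec-false (b <? c) (≤⇒≯ c≤b) = refl

  Between-above : a < c → b < c → Between a b c ≡ false
  Between-above a<c b<c rewrite dec-true (a <? c) a<c | dec-true (b <? c) b<c = refl

chords-sameSide : ∀ {a b c d} → a < b → c < d → a ≢ c → b ≢ c → a ≢ d → b ≢ d →
                  ¬ Crossing a b c d → ¬ Crossing c d a b → SameSide a b c d
chords-sameSide {a} {b} {c} {d} a<b c<d a≢c b≢c a≢d b≢d ¬abcd ¬cdab with <-cmp a c
... | tri≈ _ a≡c _ = ⊥-elim (a≢c a≡c)
... | tri< a<c _ _ with <-cmp b c
...   | tri< b<c _ _ =
          trans (Between-above a<c b<c) (sym (Between-above (<-trans a<c c<d) (<-trans b<c c<d)))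
...   | tri≈ _ b≡c _ = ⊥-elim (b≢c b≡c)
...   | tri> _ _ c<b with <-cmp b d
...     | tri< b<d _ _ = ⊥-elim (¬abcd (a<c , c<b , b<d))
...     | tri≈ _ b≡d _ = ⊥-elim (b≢d b≡d)
...     | tri> _ _ d<b =
          trans (Between-inside a<c (<⇒≤ c<b)) (sym (Between-inside (<-trans a<c c<d) (<⇒≤ d<b)))
chords-sameSide {a} {b} {c} {d} a<b c<d a≢c b≢c a≢d b≢d ¬abcd ¬cdab | tri> _ _ c<a with <-cmp a d
... | tri≈ _ a≡d _ = ⊥-elim (a≢d a≡d)
... | tri> _ _ d<a =
          trans (Between-below (<⇒≤ c<a) (<⇒≤ (<-trans c<a a<b)))
                (sym (Between-below (<⇒≤ d<a) (<⇒≤ (<-trans d<a a<b))))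
... | tri< a<d _ _ with <-cmp b d
...   | tri< b<d _ _ =
          trans (Between-below (<⇒≤ c<a) (<⇒≤ (<-trans c<a a<b))) (sym (Between-above a<d b<d))
...   | tri≈ _ b≡d _ = ⊥-elim (b≢d b≡d)
...   | tri> _ _ d<b = ⊥-elim (¬cdab (c<a , a<d , d<b))

pairings-cross : ∀ {a b c d} → b ≢ c → b ≢ d → c ≢ d →
                 SameSide a b c d → SameSide a c b d → SameSide a d b c → ⊥
pairings-cross {a} {b} {c} {d} b≢c b≢d c≢d e₁ e₂ e₃ = false≢true (begin
  false
    ≡⟨ cong₂ _xor_ (cancel e₁) (cong₂ _xor_ (cancel e₂) (cancel e₃)) ⟨
  (Between a b c xor Between a b d) xor ((Between a c b xor Between a c d) xor (Between a d b xor Between a d c))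
    ≡⟨ xor-pairings (L a c) (L b c) (L a d) (L b d) (L a b) (L c b) (L c d) (L d b) (L d c) ⟩
  (L b c xor L c b) xor ((L b d xor L d b) xor (L c d xor L d c))
    ≡⟨ cong₂ _xor_ (either b≢c) (cong₂ _xor_ (either b≢d) (either c≢d)) ⟩
  true ∎)
  where
  open ≡-Reasoning
  L : ℕ → ℕ → Bool
  L x y = does (x <? y)
  false≢true : false ≢ true
  false≢true ()
  cancel : ∀ {x y} → x ≡ y → x xor y ≡ false
  cancel {x} refl = xor-same x
  either : ∀ {x y} → x ≢ y → L x y xor L y x ≡ true
  either {x} {y} x≢y with <-cmp x y
  ... | tri< x<y _ _ rewrite dec-true (x <? y) x<y | dec-false (y <? x) (<-asym x<y) = refl
  ... | tri≈ _ x≡y _ = ⊥-elim (x≢y x≡y)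
  ... | tri> _ _ y<x rewrite dec-false (x <? y) (<-asym y<x) | dec-true (y <? x) y<x = refl

-- Paths in an outerplanar embedding

PathIn : ∀ {n} → Graph n → Pred (Fin n) 0ℓ → Rel (Fin n) 0ℓ
PathIn G X = Star (λ u v → X u × Adj G u v × X v)

PathIn-mono : ∀ {n} (G : Graph n) {X Y : Pred (Fin n) 0ℓ} → X ⊆ Y →
              ∀ {u v} → PathIn G X u v → PathIn G Y u v
PathIn-mono G X⊆Y = Star.map (λ (Xu , u-v , Xv) → X⊆Y Xu , u-v , X⊆Y Xv)

module NonCrossingEmbedding {n} (G : Graph n) (σ : Permutation′ n) (nc : NonCrossing G σ) where

  slot : Fin n → ℕ
  slot v = toℕ (σ ⟨$⟩ʳ v)

  slot-injective : ∀ {u v} → slot u ≡ slot v → u ≡ v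
  slot-injective eq = trans (sym (inverseˡ σ)) (trans (cong (σ ⟨$⟩ˡ_) (toℕ-injective eq)) (inverseˡ σ))

  slot-≢ : ∀ {u v} → u ≢ v → slot u ≢ slot v
  slot-≢ u≢v = u≢v ∘ slot-injective

  private
    sorted-edges-sameSide : ∀ {a b c d} → Adj G a b → Adj G c d → slot a < slot b → slot c < slot d →
                            a ≢ c → b ≢ c → a ≢ d → b ≢ d → SameSide (slot a) (slot b) (slot c) (slot d)
    sorted-edges-sameSide {a} {b} {c} {d} a-b c-d a<b c<d a≢c b≢c a≢d b≢d =
      chords-sameSide a<b c<d (slot-≢ a≢c) (slot-≢ b≢c) (slot-≢ a≢d) (slot-≢ b≢d)
        (nc a b c d a-b c-d) (nc c d a b c-d a-b)

    no-loop : ∀ {a b} → Adj G a b → slot a ≢ slot b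
    no-loop {a} a-b eq = irrefl G (subst (Adj G a) (sym (slot-injective eq)) a-b)

  edges-sameSide : ∀ {a b c d} → Adj G a b → Adj G c d → a ≢ c → b ≢ c → a ≢ d → b ≢ d →
                   SameSide (slot a) (slot b) (slot c) (slot d)
  edges-sameSide {a} {b} {c} {d} a-b c-d a≢c b≢c a≢d b≢d with <-cmp (slot a) (slot b) | <-cmp (slot c) (slot d)
  ... | tri≈ _ a≡b _ | _            = ⊥-elim (no-loop a-b a≡b)
  ... | _            | tri≈ _ c≡d _ = ⊥-elim (no-loop c-d c≡d)
  ... | tri< a<b _ _ | tri< c<d _ _ = sorted-edges-sameSide a-b c-d a<b c<d a≢c b≢c a≢d b≢d
  ... | tri< a<b _ _ | tri> _ _ d<c =
          sym (sorted-edges-sameSide a-b (adj-sym G c-d) a<b d<c a≢d b≢d a≢c b≢c)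
  ... | tri> _ _ b<a | tri< c<d _ _ =
          SameSide-comm (slot a) (slot b) (slot c) (slot d)
            (sorted-edges-sameSide (adj-sym G a-b) c-d b<a c<d b≢c a≢c b≢d a≢d)
  ... | tri> _ _ b<a | tri> _ _ d<c =
          SameSide-comm (slot a) (slot b) (slot c) (slot d)
            (sym (sorted-edges-sameSide (adj-sym G a-b) (adj-sym G c-d) b<a d<c b≢d a≢d b≢c a≢c))

  edge-path-sameSide : ∀ {Y a b c d} → Adj G a b → PathIn G Y c d → ¬ Y a → ¬ Y b →
                       SameSide (slot a) (slot b) (slot c) (slot d)
  edge-path-sameSide a-b ε _ _ = refl
  edge-path-sameSide {Y} a-b ((Yc , c-e , Ye) ◅ P) a∉Y b∉Y =
    trans (edges-sameSide a-b c-e (apart a∉Y Yc) (apart b∉Y Yc) (apart a∉Y Ye) (apart b∉Y Ye))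
          (edge-path-sameSide a-b P a∉Y b∉Y)
    where
    apart : ∀ {x y} → ¬ Y x → Y y → x ≢ y
    apart x∉Y Yy refl = x∉Y Yy

  paths-sameSide : ∀ {X Y a b c d} → PathIn G X a b → PathIn G Y c d → Disjoint X Y →
                   SameSide (slot a) (slot b) (slot c) (slot d)
  paths-sameSide {a = a} {c = c} {d} ε Q _ =
    trans (Between-self (slot a) (slot c)) (sym (Between-self (slot a) (slot d)))
  paths-sameSide {a = a} {b} {c} {d} ((Xa , a-e , Xe) ◅ P) Q X⊥Y = begin
    Between (slot a) (slot b) (slot c)
      ≡⟨ Between-split (slot a) (slot _) (slot b) (slot c) ⟩
    Between (slot a) (slot _) (slot c) xor Between (slot _) (slot b) (slot c)
      ≡⟨ cong₂ _xor_ (edge-path-sameSide a-e Q (X⊥Y ∘ (Xa ,_)) (X⊥Y ∘ (Xe ,_)))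
                     (paths-sameSide P Q X⊥Y) ⟩
    Between (slot a) (slot _) (slot d) xor Between (slot _) (slot b) (slot d)
      ≡⟨ Between-split (slot a) (slot _) (slot b) (slot d) ⟨
    Between (slot a) (slot b) (slot d) ∎
    where open ≡-Reasoning

module _ {m} (G : Graph (suc m))
         (boundary : ∀ {i j : Fin (suc m)} → toℕ j ≡ suc (toℕ i) → Adj G i j)
         (closing  : ∀ {i j : Fin (suc m)} → toℕ i ≡ m → toℕ j ≡ 0 → Adj G i j) where

  Within : ℕ → ℕ → Pred (Fin (suc m)) 0ℓ
  Within lo hi w = lo ≤ toℕ w × toℕ w ≤ hi

  arc : ∀ {lo hi} {i j : Fin (suc m)} → lo ≤ toℕ i → toℕ i ≤ toℕ j → toℕ j ≤ hi →
        PathIn G (Within lo hi) i j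
  arc {lo} {hi} {i} {j} lo≤i i≤j j≤hi = go (toℕ j ∸ toℕ i) lo≤i (m+[n∸m]≡n i≤j)
    where
    go : ∀ d {i} → lo ≤ toℕ i → toℕ i + d ≡ toℕ j → PathIn G (Within lo hi) i j
    go zero    {i} _    i+0≡j = subst (PathIn G _ i) (toℕ-injective (trans (sym (+-identityʳ _)) i+0≡j)) ε
    go (suc d) {i} lo≤i i+d≡j =
      ((lo≤i , ≤-trans (<⇒≤ i<j) j≤hi) , boundary (toℕ-fromℕ< i<m) , (lo≤i⁺ , i⁺≤hi))
        ◅ go d lo≤i⁺ i⁺+d≡j
      where
      i<j : toℕ i < toℕ j
      i<j = subst (toℕ i <_) i+d≡j (m<m+n (toℕ i) z<s)
      i<m : suc (toℕ i) < suc m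
      i<m = ≤-<-trans i<j (toℕ<n j)
      lo≤i⁺ : lo ≤ toℕ (fromℕ< i<m)
      lo≤i⁺ = subst (lo ≤_) (sym (toℕ-fromℕ< i<m)) (m≤n⇒m≤1+n lo≤i)
      i⁺≤hi : toℕ (fromℕ< i<m) ≤ hi
      i⁺≤hi = subst (_≤ hi) (sym (toℕ-fromℕ< i<m)) (≤-trans i<j j≤hi)
      i⁺+d≡j : toℕ (fromℕ< i<m) + d ≡ toℕ j
      i⁺+d≡j = trans (cong (_+ d) (toℕ-fromℕ< i<m)) (trans (sym (+-suc (toℕ i) d)) i+d≡j)

  crossing-chords⇒¬outerplanar : ∀ {u v x y} → Adj G u v → Adj G x y →
                                 Crossing (toℕ u) (toℕ v) (toℕ x) (toℕ y) → ¬ Outerplanar G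
  crossing-chords⇒¬outerplanar {u} {v} {x} {y} u-v x-y (u<x , x<v , v<y) (σ , nc) =
    pairings-cross (slot-≢ (<⇒≢ᶠ x<v)) (slot-≢ (<⇒≢ᶠ x<y)) (slot-≢ (<⇒≢ᶠ v<y))
      (paths-sameSide (arc ≤-refl (<⇒≤ u<x) ≤-refl) (arc ≤-refl (<⇒≤ v<y) ≤-refl) u-x⊥v-y)
      (edges-sameSide u-v x-y (<⇒≢ᶠ u<x) (≢-sym (<⇒≢ᶠ x<v)) (<⇒≢ᶠ (<-trans u<x x<y)) (<⇒≢ᶠ v<y))
      (SameSide-comm (slot u) (slot y) (slot x) (slot v)
        (paths-sameSide wrap (arc ≤-refl (<⇒≤ x<v) ≤-refl) wrap⊥x-v))
    where
    open NonCrossingEmbedding G σ nc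
    x<y : toℕ x < toℕ y
    x<y = <-trans x<v v<y
    Outside : Pred (Fin (suc m)) 0ℓ
    Outside w = toℕ y ≤ toℕ w ⊎ toℕ w ≤ toℕ u
    y≤m : toℕ y ≤ toℕ (fromℕ m)
    y≤m = subst (toℕ y ≤_) (sym (toℕ-fromℕ m)) (s≤s⁻¹ (toℕ<n y))
    wrap : PathIn G Outside y u
    wrap = PathIn-mono G (inj₁ ∘ proj₁) (arc ≤-refl y≤m (≤-reflexive (toℕ-fromℕ m)))
       ◅◅ (inj₁ y≤m , closing (toℕ-fromℕ m) refl , inj₂ z≤n)
       ◅  PathIn-mono G (inj₂ ∘ proj₂) (arc {i = zero} z≤n z≤n ≤-refl)
    u-x⊥v-y : Disjoint (Within (toℕ u) (toℕ x)) (Within (toℕ v) (toℕ y))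
    u-x⊥v-y ((_ , w≤x) , (v≤w , _)) = <-irrefl refl (≤-<-trans (≤-trans v≤w w≤x) x<v)
    wrap⊥x-v : Disjoint Outside (Within (toℕ x) (toℕ v))
    wrap⊥x-v (inj₁ y≤w , (_ , w≤v)) = <-irrefl refl (≤-<-trans (≤-trans y≤w w≤v) v<y)
    wrap⊥x-v (inj₂ w≤u , (x≤w , _)) = <-irrefl refl (≤-<-trans (≤-trans x≤w w≤u) u<x)

-- The graph H_k

Vertex : ℕ → Set
Vertex k = Fin k × Fin 3

position : ∀ {k} → Vertex k → ℕ
position (i , t) = toℕ t + toℕ i * 3

enc : ∀ {k} → Vertex k → Fin (k * 3)
enc (i , t) = combine i t

Edge : ∀ k → Vertex k → Vertex k → Set
Edge k p q = HE k p q ⊎ HE k q p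

module _ {k : ℕ} where

  decode-enc : (p : Vertex k) → decode {k} (enc p) ≡ p
  decode-enc (i , t) = remQuot-combine i t

  enc-decode : (v : Fin (k * 3)) → enc (decode {k} v) ≡ v
  enc-decode v = combine-remQuot {k} 3 v

  enc-injective : ∀ {p q : Vertex k} → enc p ≡ enc q → p ≡ q
  enc-injective {p} {q} eq = trans (sym (decode-enc p)) (trans (cong decode eq) (decode-enc q))

  toℕ-enc : (p : Vertex k) → toℕ (enc p) ≡ position p
  toℕ-enc (i , t) =
    trans (toℕ-combine i t) (trans (+-comm (3 * toℕ i) (toℕ t)) (cong (toℕ t +_) (*-comm 3 (toℕ i))))

  toℕ-decode : (v : Fin (k * 3)) → toℕ v ≡ position (decode {k} v)
  toℕ-decode v = trans (cong toℕ (sym (enc-decode v))) (toℕ-enc (decode v))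

  position-injective : ∀ {p q : Vertex k} → position p ≡ position q → p ≡ q
  position-injective {p} {q} eq =
    enc-injective (toℕ-injective (trans (toℕ-enc p) (trans eq (sym (toℕ-enc q)))))

  position<k*3 : (p : Vertex k) → position p < k * 3
  position<k*3 p = subst (_< k * 3) (toℕ-enc p) (toℕ<n (enc p))

  position-order : ∀ {u v : Fin (k * 3)} → toℕ u < toℕ v → position (decode {k} u) < position (decode {k} v)
  position-order {u} {v} = subst₂ _<_ (toℕ-decode u) (toℕ-decode v)

  position-mono : ∀ {i j : Fin k} (t s : Fin 3) → toℕ i < toℕ j → position (i , t) < position (j , s)
  position-mono {i} {j} t s i<j = begin-strict
    toℕ t + toℕ i * 3 <⟨ +-monoˡ-< (toℕ i * 3) (toℕ<n t) ⟩
    suc (toℕ i) * 3   ≤⟨ *-monoˡ-≤ 3 i<j ⟩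
    toℕ j * 3         ≤⟨ m≤n+m (toℕ j * 3) (toℕ s) ⟩
    toℕ s + toℕ j * 3 ∎
    where open ≤-Reasoning

  Edge-enc : ∀ {p q : Vertex k} → Edge k p q → Adj (H k) (enc p) (enc q)
  Edge-enc {p} {q} = subst₂ (Edge k) (sym (decode-enc p)) (sym (decode-enc q))

*3≢1+*3 : ∀ m n → m * 3 ≢ suc (n * 3)
*3≢1+*3 zero    n       ()
*3≢1+*3 (suc m) zero    ()
*3≢1+*3 (suc m) (suc n) eq = *3≢1+*3 m n (suc-injective (suc-injective (suc-injective eq)))

n≢0⇒0<n*3 : ∀ {n} → n ≢ 0 → 0 < n * 3
n≢0⇒0<n*3 {zero}  n≢0 = ⊥-elim (n≢0 refl)
n≢0⇒0<n*3 {suc n} _   = z<s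

-- The edges of H_k as position pairs p < q: side is a_i b_i, b_i c_i or c_i a_{i+1},
-- ear is a_i c_i, and fan is a₁ a_j or a₁ c_j.
data HChord : ℕ → ℕ → Set where
  side : ∀ p → HChord p (suc p)
  ear  : ∀ i → HChord (i * 3) (2 + i * 3)
  fan  : ∀ q → 0 < q → (∀ i → q ≢ 1 + i * 3) → HChord 0 q

HChord-< : ∀ {p q} → HChord p q → p < q
HChord-< (side p)      = n<1+n p
HChord-< (ear i)       = m<n+m (i * 3) z<s
HChord-< (fan q 0<q _) = 0<q

hchords-noncrossing : ∀ {u v x y} → HChord u v → HChord x y → ¬ Crossing u v x y
hchords-noncrossing (side u)     _           (u<x , x<v , _)   = <⇒≱ u<x (s≤s⁻¹ x<v)
hchords-noncrossing (ear i)      (side x)    (_ , x<v , v<y)   = <⇒≱ x<v (s≤s⁻¹ v<y)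
hchords-noncrossing (ear i)      (ear j)     (u<x , x<v , _)   = *3≢1+*3 j i (≤-antisym (s≤s⁻¹ x<v) u<x)
hchords-noncrossing (ear i)      (fan _ _ _) (() , _)
hchords-noncrossing (fan q _ _)  (side x)    (_ , x<v , v<y)   = <⇒≱ x<v (s≤s⁻¹ v<y)
hchords-noncrossing (fan q _ q≢) (ear j)     (_ , x<v , v<y)   = q≢ j (≤-antisym (s≤s⁻¹ v<y) x<v)
hchords-noncrossing (fan q _ _)  (fan _ _ _) (() , _)

HE⇒HChord : ∀ {k} {p q : Vertex k} → HE k p q →
            HChord (position p) (position q) ⊎ HChord (position q) (position p)
HE⇒HChord (ab i) = inj₁ (side _)
HE⇒HChord (bc i) = inj₁ (side _)
HE⇒HChord (ca i) = inj₂ (ear (toℕ i))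
HE⇒HChord (cnext i j j≡1+i) rewrite j≡1+i = inj₁ (side _)
HE⇒HChord (a₁a i j i≡0 j≢0) rewrite i≡0 = inj₁ (fan _ (n≢0⇒0<n*3 j≢0) (*3≢1+*3 (toℕ j)))
HE⇒HChord (a₁c i j i≡0 _)   rewrite i≡0 = inj₁ (fan _ z<s λ n eq → *3≢1+*3 n (toℕ j) (sym (suc-injective eq)))

Edge⇒HChord : ∀ {k} {p q : Vertex k} → Edge k p q →
              HChord (position p) (position q) ⊎ HChord (position q) (position p)
Edge⇒HChord (inj₁ e) = HE⇒HChord e
Edge⇒HChord (inj₂ e) = swap (HE⇒HChord e)

H-outerplanar : ∀ k → Outerplanar (H k)
H-outerplanar k = id , λ u v x y u-v x-y → noncrossing (hchord u-v) (hchord x-y)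
  where
  hchord : ∀ {u v} → Adj (H k) u v → HChord (toℕ u) (toℕ v) ⊎ HChord (toℕ v) (toℕ u)
  hchord {u} {v} e =
    subst₂ (λ a b → HChord a b ⊎ HChord b a) (sym (toℕ-decode {k} u)) (sym (toℕ-decode {k} v)) (Edge⇒HChord e)
  noncrossing : ∀ {u v x y} → HChord u v ⊎ HChord v u → HChord x y ⊎ HChord y x → ¬ Crossing u v x y
  noncrossing (inj₁ u-v) (inj₁ x-y) c               = hchords-noncrossing u-v x-y c
  noncrossing (inj₁ _)   (inj₂ y-x) (_ , x<v , v<y) = <-asym (HChord-< y-x) (<-trans x<v v<y)
  noncrossing (inj₂ v-u) _          (u<x , x<v , _) = <-asym (HChord-< v-u) (<-trans u<x x<v)

HE-successor : ∀ {k} {p q : Vertex k} → position q ≡ suc (position p) → HE k p q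
HE-successor {p = i , zero}      eq = subst (HE _ (i , aT)) (position-injective (sym eq)) (ab i)
HE-successor {p = i , suc zero}  eq = subst (HE _ (i , bT)) (position-injective (sym eq)) (bc i)
HE-successor {k} {p = i , suc (suc zero)} {q} eq =
  subst (HE k (i , cT)) (position-injective i⁺≡q) (cnext i (fromℕ< i+1<k) (toℕ-fromℕ< i+1<k))
  where
  i+1<k : suc (toℕ i) < k
  i+1<k = *-cancelʳ-< 3 (suc (toℕ i)) k (subst (_< k * 3) eq (position<k*3 q))
  i⁺≡q : position (fromℕ< i+1<k , aT) ≡ position q
  i⁺≡q = trans (cong (_* 3) (toℕ-fromℕ< i+1<k)) (sym eq)

H-boundary : ∀ {k} {u v : Fin (k * 3)} → toℕ v ≡ suc (toℕ u) → Adj (H k) u v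
H-boundary {k} {u} {v} eq =
  inj₁ (HE-successor (trans (sym (toℕ-decode {k} v)) (trans eq (cong suc (toℕ-decode {k} u)))))

H-closing : ∀ {k} {u v : Fin (suc k * 3)} → toℕ u ≡ 2 + k * 3 → toℕ v ≡ 0 → Adj (H (suc k)) u v
H-closing {k} {u} {v} u≡2+3k v≡0 =
  subst₂ (Edge (suc k)) (position-injective last≡u) (position-injective first≡v) (last-first k)
  where
  last-first : ∀ k → Edge (suc k) (fromℕ k , cT) (zero , aT)
  last-first zero    = inj₁ (ca zero)
  last-first (suc k) = inj₂ (a₁c zero (fromℕ (suc k)) refl λ ())
  last≡u : position (fromℕ k , cT) ≡ position (decode {suc k} u)
  last≡u = trans (cong (λ n → 2 + n * 3) (toℕ-fromℕ k)) (trans (sym u≡2+3k) (toℕ-decode {suc k} u))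
  first≡v : position {suc k} (zero , aT) ≡ position (decode {suc k} v)
  first≡v = trans (sym v≡0) (toℕ-decode {suc k} v)

CrossedByEdge : ∀ k → Vertex k → Vertex k → Set
CrossedByEdge k p q = ∃₂ λ r s → Edge k r s ×
  (Crossing (position p) (position q) (position r) (position s) ⊎
   Crossing (position r) (position s) (position p) (position q))

block-triangle : ∀ {k} {i : Fin k} {t s : Fin 3} → t ≢ s → Edge k (i , t) (i , s)
block-triangle {i = i} {zero}           {suc zero}       _ = inj₁ (ab i)
block-triangle {i = i} {zero}           {suc (suc zero)} _ = inj₂ (ca i)
block-triangle {i = i} {suc zero}       {zero}           _ = inj₂ (ab i)
block-triangle {i = i} {suc zero}       {suc (suc zero)} _ = inj₁ (bc i)
block-triangle {i = i} {suc (suc zero)} {zero}           _ = inj₁ (ca i)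
block-triangle {i = i} {suc (suc zero)} {suc zero}       _ = inj₂ (bc i)
block-triangle {t = zero}           {zero}           t≢s = ⊥-elim (t≢s refl)
block-triangle {t = suc zero}       {suc zero}       t≢s = ⊥-elim (t≢s refl)
block-triangle {t = suc (suc zero)} {suc (suc zero)} t≢s = ⊥-elim (t≢s refl)

hub-edge : ∀ {k} {i j : Fin k} {s : Fin 3} → toℕ i ≡ 0 → toℕ j ≢ 0 → s ≢ bT → HE k (i , aT) (j , s)
hub-edge {s = zero}           i≡0 j≢0 _   = a₁a _ _ i≡0 j≢0
hub-edge {s = suc zero}       _   _   s≢b = ⊥-elim (s≢b refl)
hub-edge {s = suc (suc zero)} i≡0 j≢0 _   = a₁c _ _ i≡0 j≢0

module _ {k : ℕ} {i j : Fin k} (i<j : toℕ i < toℕ j) where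

  crossed-from-b : (s : Fin 3) → CrossedByEdge k (i , bT) (j , s)
  crossed-from-b s = (i , aT) , (i , cT) , inj₂ (ca i) , inj₂ (n<1+n _ , n<1+n _ , position-mono cT s i<j)

  crossed-to-b : (t : Fin 3) → CrossedByEdge k (i , t) (j , bT)
  crossed-to-b t = (j , aT) , (j , cT) , inj₂ (ca j) , inj₁ (position-mono t aT i<j , n<1+n _ , n<1+n _)

module _ {k : ℕ} {i j : Fin (suc k)} (i<j : toℕ i < toℕ j) where

  private
    hub : Vertex (suc k)
    hub = zero , aT

  crossed-from-a : ∀ {s} → s ≢ bT → ¬ Edge (suc k) (i , aT) (j , s) → CrossedByEdge (suc k) (i , aT) (j , s)
  crossed-from-a {s} s≢b ¬e with toℕ i ℕ.≟ 0
  ... | yes i≡0 = ⊥-elim (¬e (inj₁ (hub-edge i≡0 (n>0⇒n≢0 (≤-<-trans z≤n i<j)) s≢b)))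
  ... | no i≢0  = hub , (i , cT) , inj₁ (hub-edge refl i≢0 λ ()) ,
                  inj₂ (n≢0⇒0<n*3 i≢0 , m<n+m _ z<s , position-mono cT s i<j)

  crossed-from-c : ∀ {s} → s ≢ bT → ¬ Edge (suc k) (i , cT) (j , s) → CrossedByEdge (suc k) (i , cT) (j , s)
  crossed-from-c {s} s≢b ¬e =
    hub , (i⁺ , aT) , inj₁ (hub-edge refl (1+n≢0 ∘ trans (sym toℕ-i⁺)) λ ()) , inj₂ (z<s , c<i⁺ , i⁺<j,s)
    where
    i+1<k : suc (toℕ i) < suc k
    i+1<k = ≤-<-trans i<j (toℕ<n j)
    i⁺ : Fin (suc k)
    i⁺ = fromℕ< i+1<k
    toℕ-i⁺ : toℕ i⁺ ≡ suc (toℕ i)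
    toℕ-i⁺ = toℕ-fromℕ< i+1<k
    c<i⁺ : position (i , cT) < position (i⁺ , aT)
    c<i⁺ = subst (position (i , cT) <_) (sym (cong (_* 3) toℕ-i⁺)) (n<1+n _)
    within-next-block : ∀ {s} → s ≢ bT → ¬ Edge (suc k) (i , cT) (i⁺ , s) →
                        position (i⁺ , aT) < position (i⁺ , s)
    within-next-block {zero}           _   ¬e = ⊥-elim (¬e (inj₁ (cnext i i⁺ toℕ-i⁺)))
    within-next-block {suc zero}       s≢b _  = ⊥-elim (s≢b refl)
    within-next-block {suc (suc zero)} _   _  = m<n+m (toℕ i⁺ * 3) {2} z<s
    i⁺<j,s : position (i⁺ , aT) < position (j , s)
    i⁺<j,s with m≤n⇒m<n∨m≡n (subst (_≤ toℕ j) (sym toℕ-i⁺) i<j)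
    ... | inj₁ i⁺<j = position-mono aT s i⁺<j
    ... | inj₂ i⁺≡j = subst (λ j → position (i⁺ , aT) < position (j , s)) (toℕ-injective i⁺≡j)
                        (within-next-block s≢b
                          (¬e ∘ subst (λ j → Edge (suc k) (i , cT) (j , s)) (toℕ-injective i⁺≡j)))

non-edge-crossed : ∀ {k} {p q : Vertex (suc k)} → position p < position q → ¬ Edge (suc k) p q →
                   CrossedByEdge (suc k) p q
non-edge-crossed {p = i , t} {j , s} p<q ¬e with <-cmp (toℕ i) (toℕ j)
... | tri> _ _ j<i = ⊥-elim (<-asym p<q (position-mono s t j<i))
... | tri≈ _ i≡j _ = ⊥-elim (¬e (subst (λ j → Edge _ (i , t) (j , s)) (toℕ-injective i≡j) (block-triangle t≢s)))
  where
  t≢s : t ≢ s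
  t≢s refl = <-irrefl (cong (λ n → toℕ t + n * 3) i≡j) p<q
... | tri< i<j _ _ = across t s ¬e
  where
  across : ∀ t s → ¬ Edge _ (i , t) (j , s) → CrossedByEdge _ (i , t) (j , s)
  across (suc zero)       s                _ = crossed-from-b i<j s
  across t                (suc zero)       _ = crossed-to-b i<j t
  across zero             zero               = crossed-from-a i<j λ ()
  across zero             (suc (suc zero))   = crossed-from-a i<j λ ()
  across (suc (suc zero)) zero               = crossed-from-c i<j λ ()
  across (suc (suc zero)) (suc (suc zero))   = crossed-from-c i<j λ ()

Crossing-resp : ∀ {a b c d a′ b′ c′ d′} → a ≡ a′ → b ≡ b′ → c ≡ c′ → d ≡ d′ →
                Crossing a b c d → Crossing a′ b′ c′ d′
Crossing-resp refl refl refl refl x = x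

module _ {k : ℕ} (G : Graph (suc k * 3)) (H⊆G : ∀ {u v} → Adj (H (suc k)) u v → Adj G u v) where

  private
    boundary : ∀ {u v : Fin (suc k * 3)} → toℕ v ≡ suc (toℕ u) → Adj G u v
    boundary eq = H⊆G (H-boundary eq)

    closing : ∀ {u v : Fin (suc k * 3)} → toℕ u ≡ 2 + k * 3 → toℕ v ≡ 0 → Adj G u v
    closing u≡last v≡0 = H⊆G (H-closing u≡last v≡0)

    crossed⇒¬outerplanar : ∀ {u v} → Adj G u v → CrossedByEdge (suc k) (decode u) (decode v) → ¬ Outerplanar G
    crossed⇒¬outerplanar {u} {v} u-v (r , s , r-s , inj₁ c) =
      crossing-chords⇒¬outerplanar G boundary closing u-v (H⊆G (Edge-enc r-s))
        (Crossing-resp (sym (toℕ-decode u)) (sym (toℕ-decode v)) (sym (toℕ-enc r)) (sym (toℕ-enc s)) c)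
    crossed⇒¬outerplanar {u} {v} u-v (r , s , r-s , inj₂ c) =
      crossing-chords⇒¬outerplanar G boundary closing (H⊆G (Edge-enc r-s)) u-v
        (Crossing-resp (sym (toℕ-enc r)) (sym (toℕ-enc s)) (sym (toℕ-decode u)) (sym (toℕ-decode v)) c)

  non-edge⇒¬outerplanar : ∀ {u v} → Adj G u v → ¬ Adj (H (suc k)) u v → ¬ Outerplanar G
  non-edge⇒¬outerplanar {u} {v} u-v ¬u-v with <-cmp (toℕ u) (toℕ v)
  ... | tri< u<v _ _ = crossed⇒¬outerplanar u-v (non-edge-crossed (position-order u<v) ¬u-v)
  ... | tri≈ _ u≡v _ = ⊥-elim (irrefl G (subst (Adj G u) (sym (toℕ-injective u≡v)) u-v))
  ... | tri> _ _ v<u = crossed⇒¬outerplanar (adj-sym G u-v)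
                         (non-edge-crossed {p = decode v} {decode u} (position-order v<u)
                           (¬u-v ∘ adj-sym (H (suc k)) {v} {u}))

H-maximal : ∀ {k} (u v : Fin (suc k * 3)) (u≢v : u ≢ v) → ¬ Adj (H (suc k)) u v →
            ¬ Outerplanar (addEdge (H (suc k)) u v u≢v)
H-maximal {k} u v u≢v = non-edge⇒¬outerplanar (addEdge (H (suc k)) u v u≢v) inj₁ (inj₂ (inj₁ (refl , refl)))

-- Secure total domination

x∉p-x : ∀ {n} (p : Subset n) (x : Fin n) → x ∉ p - x
x∉p-x (_ ∷ p) zero    ()
x∉p-x (_ ∷ p) (suc x) (there x∈p-x) = x∉p-x p x x∈p-x

∣p++q∣ : ∀ {m n} (p : Subset m) (q : Subset n) → ∣ p ++ q ∣ ≡ ∣ p ∣ + ∣ q ∣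
∣p++q∣ []            q = refl
∣p++q∣ (inside  ∷ p) q = cong suc (∣p++q∣ p q)
∣p++q∣ (outside ∷ p) q = ∣p++q∣ p q

module _ {n} (G : Graph n) {T : Subset n} (secure : SecureTotalDominating G T) where

  two-defenders : ∀ {b} → b ∉ T → ∃₂ λ z₀ z₁ → z₀ ≢ z₁ × z₀ ∈ T × z₁ ∈ T × Adj G b z₀ × Adj G b z₁
  two-defenders {b} b∉T with proj₂ secure b b∉T
  ... | z₀ , z₀∈T , b-z₀ , dominates with dominates b
  ...   | z₁ , z₁∈T′ , b-z₁ with x∈p∪q⁻ (T - z₀) ⁅ b ⁆ z₁∈T′
  ...     | inj₂ z₁∈⁅b⁆ = ⊥-elim (irrefl G (subst (Adj G b) (x∈⁅y⁆⇒x≡y b z₁∈⁅b⁆) b-z₁))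
  ...     | inj₁ z₁∈T-z₀ =
            z₀ , z₁ , (λ { refl → x∉p-x T z₀ z₁∈T-z₀ }) , z₀∈T , p─q⊆p T ⁅ z₀ ⁆ z₁∈T-z₀ , b-z₀ , b-z₁

  secure-degree-two : ∀ {b p q} → (∀ {z} → Adj G b z → z ≡ p ⊎ z ≡ q) → b ∉ T → p ∈ T × q ∈ T
  secure-degree-two N[b]⊆pq b∉T with two-defenders b∉T
  ... | z₀ , z₁ , z₀≢z₁ , z₀∈T , z₁∈T , b-z₀ , b-z₁ with N[b]⊆pq b-z₀ | N[b]⊆pq b-z₁
  ...   | inj₁ refl | inj₂ refl = z₀∈T , z₁∈T
  ...   | inj₂ refl | inj₁ refl = z₁∈T , z₀∈T
  ...   | inj₁ refl | inj₁ refl = ⊥-elim (z₀≢z₁ refl)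
  ...   | inj₂ refl | inj₂ refl = ⊥-elim (z₀≢z₁ refl)

module _ {k : ℕ} where

  ∀-vertex : {P : Fin (k * 3) → Set} → (∀ p → P (enc p)) → ∀ v → P v
  ∀-vertex {P} P∘enc v = subst P (enc-decode {k} v) (P∘enc (decode {k} v))

  b-neighbours : (i : Fin k) → ∀ {z} → Adj (H k) (enc (i , bT)) z → z ≡ enc (i , aT) ⊎ z ≡ enc (i , cT)
  b-neighbours i {z} b-z =
    ⊎-map decode≡⇒≡enc decode≡⇒≡enc
      (edge-from-b (subst (λ p → Edge k p (decode {k} z)) (decode-enc (i , bT)) b-z))
    where
    decode≡⇒≡enc : ∀ {p} → decode {k} z ≡ p → z ≡ enc p
    decode≡⇒≡enc eq = trans (sym (enc-decode {k} z)) (cong enc eq)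
    edge-from-b : ∀ {q} → Edge k (i , bT) q → q ≡ (i , aT) ⊎ q ≡ (i , cT)
    edge-from-b (inj₁ (bc i)) = inj₂ refl
    edge-from-b (inj₂ (ab i)) = inj₁ refl

  block : Subset (k * 3) → Fin k → Subset 3
  block T i = lookup T (enc (i , aT)) ∷ lookup T (enc (i , bT)) ∷ lookup T (enc (i , cT)) ∷ []

two-of-three : ∀ (B : Subset 3) →
               (lookup B aT ≡ inside × lookup B cT ≡ inside) ⊎
               (lookup B bT ≡ inside × (lookup B aT ≡ inside ⊎ lookup B cT ≡ inside)) → 2 ≤ ∣ B ∣
two-of-three (_ ∷ y ∷ _ ∷ []) (inj₁ (refl , refl))      = s≤s (∣p∣≤∣x∷p∣ y (inside ∷ []))
two-of-three (_ ∷ _ ∷ _ ∷ []) (inj₂ (refl , inj₁ refl)) = s≤s (s≤s z≤n)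
two-of-three (x ∷ _ ∷ _ ∷ []) (inj₂ (refl , inj₂ refl)) = ∣p∣≤∣x∷p∣ x (inside ∷ inside ∷ [])

secure-block : ∀ {k} {T : Subset (k * 3)} → SecureTotalDominating (H k) T → ∀ i → 2 ≤ ∣ block {k} T i ∣
secure-block {k} {T} secure i with enc (i , bT) ∈? T
... | yes b∈T with proj₁ secure (enc (i , bT))
...   | z , z∈T , b-z with b-neighbours i b-z
...     | inj₁ refl = two-of-three (block T i) (inj₂ ([]=⇒lookup b∈T , inj₁ ([]=⇒lookup z∈T)))
...     | inj₂ refl = two-of-three (block T i) (inj₂ ([]=⇒lookup b∈T , inj₂ ([]=⇒lookup z∈T)))
secure-block {k} {T} secure i | no b∉T with secure-degree-two (H k) secure (b-neighbours i) b∉T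
... | a∈T , c∈T = two-of-three (block T i) (inj₁ ([]=⇒lookup a∈T , []=⇒lookup c∈T))

blocks-bound : ∀ {m} k (T : Subset (k * 3)) → (∀ i → m ≤ ∣ block {k} T i ∣) → k * m ≤ ∣ T ∣
blocks-bound zero    []                _     = z≤n
blocks-bound (suc k) (x ∷ y ∷ z ∷ T) bound =
  subst (_ ≤_) (sym (∣p++q∣ (x ∷ y ∷ z ∷ []) T)) (+-mono-≤ (bound zero) (blocks-bound k T (bound ∘ suc)))

secure-lower-bound : ∀ {k} {T : Subset (k * 3)} → SecureTotalDominating (H k) T → k * 2 ≤ ∣ T ∣
secure-lower-bound {k} {T} secure = blocks-bound k T (secure-block secure)

∣S₀∣ : ∀ k → ∣ S₀ k ∣ ≡ k * 2
∣S₀∣ zero    = refl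
∣S₀∣ (suc k) = cong (2 +_) (∣S₀∣ k)

module _ {k : ℕ} where

  private
    ac∈S₀ : ∀ i {t} → isAC t ≡ true → enc {k} (i , t) ∈ S₀ k
    ac∈S₀ i {t} isAC-t = lookup⇒[]= (enc (i , t)) (S₀ k) (begin
      lookup (S₀ k) (enc (i , t))             ≡⟨ lookup∘tabulate _ (enc (i , t)) ⟩
      isAC (proj₂ (decode {k} (enc (i , t)))) ≡⟨ cong (isAC ∘ proj₂) (decode-enc (i , t)) ⟩
      isAC t                                  ≡⟨ isAC-t ⟩
      true                                    ∎)
      where open ≡-Reasoning

    type-≢ : ∀ {i j : Fin k} {t s} → t ≢ s → enc (i , t) ≢ enc (j , s)
    type-≢ t≢s = t≢s ∘ cong proj₂ ∘ enc-injective {k}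

    kept : ∀ {S : Subset (k * 3)} {v u w} → w ∈ S → w ≢ v → w ∈ swapIn S v u
    kept w∈S w≢v = x∈p∪q⁺ (inj₁ (x∈p∧x≢y⇒x∈p-y w∈S w≢v))

    added : ∀ {S : Subset (k * 3)} {v u} → u ∈ swapIn S v u
    added {u = u} = x∈p∪q⁺ (inj₂ (x∈⁅x⁆ u))

    S₀-dominates : ∀ p → ∃ λ z → z ∈ S₀ k × Adj (H k) (enc p) z
    S₀-dominates (i , zero)           = enc (i , cT) , ac∈S₀ i refl , Edge-enc (inj₂ (ca i))
    S₀-dominates (i , suc zero)       = enc (i , aT) , ac∈S₀ i refl , Edge-enc (inj₂ (ab i))
    S₀-dominates (i , suc (suc zero)) = enc (i , aT) , ac∈S₀ i refl , Edge-enc (inj₁ (ca i))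

    swap-dominates : ∀ i p → ∃ λ z → z ∈ swapIn (S₀ k) (enc (i , aT)) (enc (i , bT)) × Adj (H k) (enc p) z
    swap-dominates i (j , zero)     = enc (j , cT) , kept (ac∈S₀ j refl) (type-≢ λ ()) , Edge-enc (inj₂ (ca j))
    swap-dominates i (j , suc zero) = enc (j , cT) , kept (ac∈S₀ j refl) (type-≢ λ ()) , Edge-enc (inj₁ (bc j))
    swap-dominates i (j , suc (suc zero)) with j ≟ i
    ... | yes refl = enc (i , bT) , added , Edge-enc (inj₂ (bc i))
    ... | no j≢i   =
      enc (j , aT) , kept (ac∈S₀ j refl) (j≢i ∘ cong proj₁ ∘ enc-injective) , Edge-enc (inj₁ (ca j))

    defend : ∀ p → enc p ∉ S₀ k →
             ∃ λ z → z ∈ S₀ k × Adj (H k) (enc p) z × TotalDominating (H k) (swapIn (S₀ k) z (enc p))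
    defend (i , zero)           a∉S₀ = ⊥-elim (a∉S₀ (ac∈S₀ i refl))
    defend (i , suc zero)       _    =
      enc (i , aT) , ac∈S₀ i refl , Edge-enc (inj₂ (ab i)) , ∀-vertex (swap-dominates i)
    defend (i , suc (suc zero)) c∉S₀ = ⊥-elim (c∉S₀ (ac∈S₀ i refl))

  S₀-secure : SecureTotalDominating (H k) (S₀ k)
  S₀-secure = ∀-vertex S₀-dominates , ∀-vertex {P = λ u → u ∉ S₀ k → _} defend

mainTheorem4 : ∀ (k : ℕ) → 1 ≤ k →
    MaximalOuterplanar (H k) ×
    γst≡ (H k) (2 * k) ×
    2 * k ≡ (2 * (k * 3)) / 3 ×
    MinimumSTDS (H k) (S₀ k) × ∣ S₀ k ∣ ≡ 2 * k
mainTheorem4 (suc k) _ =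
    (H-outerplanar (suc k) , H-maximal)
  , ((S₀ (suc k) , S₀-secure , ∣S₀∣≡2k) , lower-bound)
  , sym (trans (cong (_/ 3) (sym (*-assoc 2 (suc k) 3))) (m*n/n≡m (2 * suc k) 3))
  , (S₀-secure , λ T secure → subst (_≤ ∣ T ∣) (sym ∣S₀∣≡2k) (lower-bound T secure))
  , ∣S₀∣≡2k
  where
  ∣S₀∣≡2k : ∣ S₀ (suc k) ∣ ≡ 2 * suc k
  ∣S₀∣≡2k = trans (∣S₀∣ (suc k)) (*-comm (suc k) 2)
  lower-bound : ∀ T → SecureTotalDominating (H (suc k)) T → 2 * suc k ≤ ∣ T ∣
  lower-bound T secure = subst (_≤ ∣ T ∣) (*-comm (suc k) 2) (secure-lower-bound secure)
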